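{- Let $s>r\ge0$, $n=s+r$, and let $\pi\in S_n$ have Robinson–Schensted shape $\lambda$ with $\lambda'=(s,r)$ (two columns, of lengths $s$ and $r$). Then there exists $p\in[n]$ such that $\pi\setminus\{p\}$ has a longest decreasing subsequence of length $s-1$. Moreover, $p$ belongs to every longest decreasing subsequence of $\pi$.
   Context: $\lambda'$ denotes the conjugate partition. For a permutation $\pi$ in one-line notation and $p\in[n]$, $\pi\setminus\{p\}$ denotes the sequence of length $n-1$ obtained by deleting the entry $p$ from $\pi$. A longest decreasing subsequence (LDS) is a decreasing subsequence of maximal length. -}

module Defs where

open import Data.Nat using (ℕ; zero; suc; _≤_; _<_; _>_; _≤?_; _<?_)
open import Data.Nat.Properties using (_≟_)
open import Data.List using (List; []; _∷_; length; map; filter; foldl; upTo)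
open import Data.List.Relation.Binary.Sublist.Propositional using (_⊆_)
open import Data.List.Relation.Unary.Linked using (Linked)
open import Data.List.Relation.Binary.Permutation.Propositional using (_↭_)
open import Data.List.Membership.Propositional using (_∈_)
open import Data.Maybe using (Maybe; just; nothing)
open import Data.Product using (Σ; _×_; _,_)
open import Relation.Binary.PropositionalEquality using (_≡_)
open import Relation.Nullary using (¬_; yes; no)
open import Relation.Nullary.Decidable using (¬?)

-- A permutation of [n] = {1,…,n} in one-line notation.
IsPerm : ℕ → List ℕ → Set
IsPerm n π = π ↭ map suc (upTo n)

-- Robinson–Schensted row insertion (P-tableau), rows listed top to bottom.

rowInsert : ℕ → List ℕ → List ℕ × Maybe ℕ
rowInsert x [] = x ∷ [] , nothing
rowInsert x (y ∷ ys) with x <? y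
... | yes _ = x ∷ ys , just y
... | no _ with rowInsert x ys
...   | ys' , b = y ∷ ys' , b

Tableau : Set
Tableau = List (List ℕ)

insertT : ℕ → Tableau → Tableau
insertT x [] = (x ∷ []) ∷ []
insertT x (row ∷ rows) with rowInsert x row
... | row' , nothing = row' ∷ rows
... | row' , just y  = row' ∷ insertT y rows

RSP : List ℕ → Tableau
RSP π = foldl (λ T x → insertT x T) [] π

shape : List ℕ → List ℕ
shape π = map length (RSP π)

headOr0 : List ℕ → ℕ
headOr0 [] = 0
headOr0 (x ∷ _) = x

conjugate : List ℕ → List ℕ
conjugate λ₀ = map (λ j → length (filter (λ m → suc j ≤? m) λ₀)) (upTo (headOr0 λ₀))

-- The partition (s, r) with trailing zero part dropped.
twoParts : ℕ → ℕ → List ℕ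
twoParts s zero = s ∷ []
twoParts s (suc r) = s ∷ suc r ∷ []

IsDecSubseq : List ℕ → List ℕ → Set
IsDecSubseq σ π = (σ ⊆ π) × Linked _>_ σ

IsLDS : List ℕ → List ℕ → Set
IsLDS σ π = IsDecSubseq σ π × (∀ τ → IsDecSubseq τ π → length τ ≤ length σ)

HasLDSLength : List ℕ → ℕ → Set
HasLDSLength π k = Σ (List ℕ) (λ σ → IsLDS σ π × length σ ≡ k)

deleteEntry : ℕ → List ℕ → List ℕ
deleteEntry p π = filter (λ x → ¬? (x ≟ p)) π

-- By Schensted's theorem the longest decreasing subsequences of π have length s, the number of rows of
-- its insertion tableau. Grading each letter by the length of the longest decreasing subsequence starting
-- at it splits π into s increasing classes, and every longest decreasing subsequence meets each class
-- exactly once. Fix one, σ₀: the r < s letters outside σ₀ miss some class, so that class is a single letter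
-- p of σ₀. Then p lies on every longest decreasing subsequence, and deleting it lowers the maximum to s − 1.
-- Schensted's theorem is proved with Knuth-type moves: bumping within one row changes, in no context, the
-- maximal length of a decreasing subsequence, and the reading word of a tableau with weakly increasing rows
-- has no decreasing subsequence longer than its first column.

module Submission where

open import Defs
open import Data.Empty using (⊥-elim)
open import Data.List using (List; []; _∷_; _++_; [_]; length; map; filter; foldl; upTo)
open import Data.List.Properties
  using ( ++-assoc; ++-identityʳ; ∷-injectiveˡ; length-++; length-map; length-applyUpTo
        ; filter-all; filter-accept; filter-reject; filter-notAll)
open import Data.List.Membership.Propositional using (_∈_; _∉_)
open import Data.List.Membership.Propositional.Properties
  using (∈-map⁻; ∈-map⁺; ∈-upTo⁻; ∈-filter⁺; ∈-filter⁻)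
open import Data.List.Relation.Binary.Permutation.Propositional using (↭-sym; ↭⇒↭ₛ′)
open import Data.List.Relation.Binary.Permutation.Propositional.Properties using (∈-resp-↭; ↭-length)
import Data.List.Relation.Binary.Permutation.Setoid.Properties as ↭ₛ
open import Data.List.Relation.Binary.Sublist.Propositional
  using (_⊆_; []; _∷_; _∷ʳ_; ⊆-refl; ⊆-trans; lookup; from∈)
open import Data.List.Relation.Binary.Sublist.Propositional.Properties
  using ([]⊆-universal; ++⁺ˡ; ++⁺ʳ; filter-⊆; length-mono-≤)
  renaming (++⁺ to ⊆-++⁺; filter⁺ to ⊆-filter⁺)
open import Data.List.Relation.Unary.All as All using (All; []; _∷_)
import Data.List.Relation.Unary.All.Properties as All
open import Data.List.Relation.Unary.AllPairs as AllPairs using (AllPairs; []; _∷_)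
import Data.List.Relation.Unary.AllPairs.Properties as AllPairs
open import Data.List.Relation.Unary.Any using (here; there)
import Data.List.Relation.Unary.Any as Any
open import Data.List.Relation.Unary.Linked.Properties using (AllPairs⇒Linked; Linked⇒AllPairs)
open import Data.List.Relation.Unary.Unique.Propositional using (Unique)
import Data.List.Relation.Unary.Unique.Propositional.Properties as Unique
open import Data.Maybe using (just; nothing)
open import Data.Nat using (ℕ; zero; suc; _+_; _∸_; _≤_; _<_; _>_; _⊔_; z≤n; s≤s; _<?_; _≤?_)
open import Data.Nat.Properties
open import Data.List.Membership.DecPropositional _≟_ using (_∈?_)
open import Data.Product using (Σ; _×_; _,_; proj₁; proj₂)
open import Data.Sum using (_⊎_; inj₁; inj₂)
open import Data.Unit using (⊤; tt)
open import Relation.Binary.PropositionalEquality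
  using (_≡_; _≢_; refl; sym; trans; cong; subst; setoid; isEquivalence)
open import Relation.Nullary using (yes; no)
open import Relation.Nullary.Decidable using (¬?)
open import Relation.Unary using (Decidable)

private variable
  A : Set
  k : ℕ
  x y : A
  xs ys : List A

Decreasing : List ℕ → Set
Decreasing = AllPairs _>_

>-trans : ∀ {a b c : ℕ} → a > b → b > c → a > c
>-trans a>b b>c = <-trans b>c a>b

HasDecSubseq≥ : List ℕ → ℕ → Set
HasDecSubseq≥ w n = Σ (List ℕ) λ τ → τ ⊆ w × Decreasing τ × n ≤ length τ

DecSubseqOfLength : List ℕ → ℕ → List ℕ → Set
DecSubseqOfLength w n σ = σ ⊆ w × Decreasing σ × length σ ≡ n

⊆-++-split : ∀ (xs : List A) {ys σ} → σ ⊆ xs ++ ys →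
  Σ (List A) λ σ₁ → Σ (List A) λ σ₂ → σ ≡ σ₁ ++ σ₂ × σ₁ ⊆ xs × σ₂ ⊆ ys
⊆-++-split [] σ⊆ys = [] , _ , refl , [] , σ⊆ys
⊆-++-split (x ∷ xs) (.x ∷ʳ σ⊆) with ⊆-++-split xs σ⊆
... | σ₁ , σ₂ , eq , σ₁⊆ , σ₂⊆ = σ₁ , σ₂ , eq , x ∷ʳ σ₁⊆ , σ₂⊆
⊆-++-split (x ∷ xs) (refl ∷ σ⊆) with ⊆-++-split xs σ⊆
... | σ₁ , σ₂ , refl , σ₁⊆ , σ₂⊆ = x ∷ σ₁ , σ₂ , refl , refl ∷ σ₁⊆ , σ₂⊆

⊆-pairs : ∀ {σ w : List A} → σ ⊆ w → AllPairs (λ a b → a ∷ b ∷ [] ⊆ w) σ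
⊆-pairs [] = []
⊆-pairs (y ∷ʳ σ⊆) = AllPairs.map (y ∷ʳ_) (⊆-pairs σ⊆)
⊆-pairs (refl ∷ σ⊆) =
  All.tabulate (λ m → refl ∷ from∈ (lookup σ⊆ m)) ∷ AllPairs.map (_ ∷ʳ_) (⊆-pairs σ⊆)

module _ {R : A → A → Set} where

  AllPairs-++⁻ : ∀ xs → AllPairs R (xs ++ ys) →
    AllPairs R xs × AllPairs R ys × All (λ x → All (R x) ys) xs
  AllPairs-++⁻ [] rs = [] , rs , []
  AllPairs-++⁻ (x ∷ xs) (r ∷ rs) with AllPairs-++⁻ xs rs
  ... | rxs , rys , across = All.++⁻ˡ xs r ∷ rxs , rys , All.++⁻ʳ xs r ∷ across

  All-transpose : All (λ x → All (R x) ys) xs → All (λ y → All (λ x → R x y) xs) ys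
  All-transpose {ys = []} _ = []
  All-transpose {ys = y ∷ ys} rs = All.map All.head rs ∷ All-transpose (All.map All.tail rs)

AllPairs-injective : ∀ (f : A → ℕ) {xs} → AllPairs (λ a b → f a ≢ f b) xs →
  x ∈ xs → y ∈ xs → f x ≡ f y → x ≡ y
AllPairs-injective f _ (here refl) (here refl) _ = refl
AllPairs-injective f (d ∷ _) (here refl) (there m) e = ⊥-elim (All.lookup d m e)
AllPairs-injective f (d ∷ _) (there m) (here refl) e = ⊥-elim (All.lookup d m (sym e))
AllPairs-injective f (_ ∷ ds) (there m) (there m′) e = AllPairs-injective f ds m m′ e

decreasing-length-≤ : ∀ {xs} → Decreasing xs → All (_< k) xs → length xs ≤ k
decreasing-length-≤ [] [] = z≤n
decreasing-length-≤ (x>xs ∷ dec) (x<k ∷ _) = ≤-trans (s≤s (decreasing-length-≤ dec x>xs)) x<k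

decreasing-covers : ∀ {xs} → Decreasing xs → All (_< length xs) xs → ∀ {i} → i < length xs → i ∈ xs
decreasing-covers (x>xs ∷ dec) (x<n ∷ _) i<n
  with ≤-antisym (m<1+n⇒m≤n x<n) (decreasing-length-≤ dec x>xs) | m<1+n⇒m<n∨m≡n i<n
... | refl | inj₂ refl = here refl
... | refl | inj₁ i<len = there (decreasing-covers dec x>xs i<len)

∃-∉-below : ∀ k (xs : List ℕ) → length xs < k → Σ ℕ λ i → i < k × i ∉ xs
∃-∉-below (suc k) xs |xs|<1+k with k ∈? xs
... | no k∉xs = k , ≤-refl , k∉xs
... | yes k∈xs with ∃-∉-below k (deleteEntry k xs) |xs∖k|<k
  where
  |xs∖k|<k : length (deleteEntry k xs) < k
  |xs∖k|<k = <-≤-trans (filter-notAll (λ y → ¬? (y ≟ k)) xs (Any.map (λ k≡y y≢k → y≢k (sym k≡y)) k∈xs))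
                       (m<1+n⇒m≤n |xs|<1+k)
... | i , i<k , i∉ =
  i , m<n⇒m<1+n i<k , λ i∈xs → i∉ (∈-filter⁺ (λ y → ¬? (y ≟ k)) i∈xs (λ i≡k → <-irrefl i≡k i<k))

module _ {P : A → Set} (P? : Decidable P) where

  length-filter-∁ : ∀ xs → length (filter P? xs) + length (filter (λ x → ¬? (P? x)) xs) ≡ length xs
  length-filter-∁ [] = refl
  length-filter-∁ (x ∷ xs) with P? x
  ... | yes _ = cong suc (length-filter-∁ xs)
  ... | no _ = trans (+-suc _ _) (cong suc (length-filter-∁ xs))

length-deleteEntry : ∀ {p σ} → Unique σ → p ∈ σ → suc (length (deleteEntry p σ)) ≡ length σ
length-deleteEntry {σ = x ∷ σ} (x∉σ ∷ _) (here refl)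
  rewrite filter-reject (λ y → ¬? (y ≟ x)) {x} {σ} (λ x≢x → x≢x refl)
        | filter-all (λ y → ¬? (y ≟ x)) {σ} (All.map (λ x≢y y≡x → x≢y (sym y≡x)) x∉σ) = refl
length-deleteEntry {p} {x ∷ σ} (x∉σ ∷ u) (there p∈σ) with x ≟ p
... | yes refl = ⊥-elim (All.lookup x∉σ p∈σ refl)
... | no x≢p rewrite filter-accept (λ y → ¬? (y ≟ p)) {x} {σ} x≢p = cong suc (length-deleteEntry u p∈σ)

-- Schensted's theorem for decreasing subsequences

infix 4 _≼_ _≍_ _⊴_

_≼_ : List ℕ → List ℕ → Set
w₁ ≼ w₂ = ∀ p v σ → σ ⊆ p ++ w₁ ++ v → Decreasing σ → HasDecSubseq≥ (p ++ w₂ ++ v) (length σ)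

≼-refl : ∀ {w} → w ≼ w
≼-refl p v σ σ⊆ dec = σ , σ⊆ , dec , ≤-refl

≼-trans : ∀ {w₁ w₂ w₃} → w₁ ≼ w₂ → w₂ ≼ w₃ → w₁ ≼ w₃
≼-trans f g p v σ σ⊆ dec with f p v σ σ⊆ dec
... | τ , τ⊆ , dec′ , σ≤τ with g p v τ τ⊆ dec′
... | ρ , ρ⊆ , dec″ , τ≤ρ = ρ , ρ⊆ , dec″ , ≤-trans σ≤τ τ≤ρ

≼-prefix : ∀ a {w₁ w₂} → w₁ ≼ w₂ → a ++ w₁ ≼ a ++ w₂
≼-prefix a {w₁} {w₂} f p v σ σ⊆ dec
  rewrite ++-assoc a w₁ v | sym (++-assoc p a (w₁ ++ v))
        | ++-assoc a w₂ v | sym (++-assoc p a (w₂ ++ v)) = f (p ++ a) v σ σ⊆ dec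

≼-suffix : ∀ c {w₁ w₂} → w₁ ≼ w₂ → w₁ ++ c ≼ w₂ ++ c
≼-suffix c {w₁} {w₂} f p v σ σ⊆ dec rewrite ++-assoc w₁ c v | ++-assoc w₂ c v = f p (c ++ v) σ σ⊆ dec

_≍_ : List ℕ → List ℕ → Set
w₁ ≍ w₂ = w₁ ≼ w₂ × w₂ ≼ w₁

≍-reflexive : ∀ {w₁ w₂} → w₁ ≡ w₂ → w₁ ≍ w₂
≍-reflexive refl = ≼-refl , ≼-refl

≍-trans : ∀ {w₁ w₂ w₃} → w₁ ≍ w₂ → w₂ ≍ w₃ → w₁ ≍ w₃
≍-trans (f , f′) (g , g′) = ≼-trans f g , ≼-trans g′ f′

≍-prefix : ∀ a {w₁ w₂} → w₁ ≍ w₂ → a ++ w₁ ≍ a ++ w₂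
≍-prefix a (f , g) = ≼-prefix a f , ≼-prefix a g

≍-suffix : ∀ c {w₁ w₂} → w₁ ≍ w₂ → w₁ ++ c ≍ w₂ ++ c
≍-suffix c (f , g) = ≼-suffix c f , ≼-suffix c g

BoundedBy : List ℕ → List ℕ → Set
BoundedBy μ′ μ = (∀ a → All (a >_) μ → All (a >_) μ′) × (∀ c → All (_> c) μ → All (_> c) μ′)

BoundedBy-refl : ∀ {μ} → BoundedBy μ μ
BoundedBy-refl = (λ _ a>μ → a>μ) , (λ _ μ>c → μ>c)

ReplacementIn : List ℕ → List ℕ → Set
ReplacementIn M′ μ = Σ (List ℕ) λ μ′ → μ′ ⊆ M′ × Decreasing μ′ × length μ ≤ length μ′ × BoundedBy μ′ μ

ReplacementIn-⊆ : ∀ {M′ M″ μ} → M′ ⊆ M″ → ReplacementIn M′ μ → ReplacementIn M″ μ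
ReplacementIn-⊆ M′⊆ (μ′ , μ′⊆ , dec , μ≤μ′ , bounded) = μ′ , ⊆-trans μ′⊆ M′⊆ , dec , μ≤μ′ , bounded

_⊴_ : List ℕ → List ℕ → Set
M ⊴ M′ = ∀ μ → μ ⊆ M → Decreasing μ → ReplacementIn M′ μ

-- BoundedBy is what lets μ′ be spliced back between the parts of σ before and after the block.
⊴⇒≼ : ∀ {M M′} → M ⊴ M′ → M ≼ M′
⊴⇒≼ {M} {M′} M⊴M′ p v σ σ⊆ dec with ⊆-++-split p σ⊆
... | σ₁ , σ₂₃ , refl , σ₁⊆ , σ₂₃⊆ with ⊆-++-split M σ₂₃⊆
... | σ₂ , σ₃ , refl , σ₂⊆ , σ₃⊆ with AllPairs-++⁻ σ₁ dec
... | dec₁ , dec₂₃ , σ₁>σ₂₃ with AllPairs-++⁻ σ₂ dec₂₃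
... | dec₂ , dec₃ , σ₂>σ₃ with M⊴M′ σ₂ σ₂⊆ dec₂
... | μ′ , μ′⊆ , decμ′ , σ₂≤μ′ , (upper , lower) =
  σ₁ ++ μ′ ++ σ₃ , ⊆-++⁺ σ₁⊆ (⊆-++⁺ μ′⊆ σ₃⊆) ,
  AllPairs.++⁺ dec₁ (AllPairs.++⁺ decμ′ dec₃ μ′>σ₃) σ₁>μ′σ₃ , length-≤
  where
  μ′>σ₃ : All (λ x → All (x >_) σ₃) μ′
  μ′>σ₃ = All-transpose (All.map (λ {c} → lower c) (All-transpose σ₂>σ₃))
  σ₁>μ′σ₃ : All (λ x → All (x >_) (μ′ ++ σ₃)) σ₁
  σ₁>μ′σ₃ =
    All.map (λ {a} a>σ₂σ₃ → All.++⁺ (upper a (All.++⁻ˡ σ₂ a>σ₂σ₃)) (All.++⁻ʳ σ₂ a>σ₂σ₃)) σ₁>σ₂₃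
  length-≤ : length (σ₁ ++ σ₂ ++ σ₃) ≤ length (σ₁ ++ μ′ ++ σ₃)
  length-≤ rewrite length-++ σ₁ {σ₂ ++ σ₃} | length-++ σ₂ {σ₃}
                 | length-++ σ₁ {μ′ ++ σ₃} | length-++ μ′ {σ₃} =
    +-monoʳ-≤ (length σ₁) (+-monoˡ-≤ (length σ₃) σ₂≤μ′)

⊆-below-empty : ∀ {y : ℕ} {w μ} → All (y ≤_) w → μ ⊆ w → All (y >_) μ → μ ≡ []
⊆-below-empty _ [] _ = refl
⊆-below-empty (_ ∷ y≤w) (_ ∷ʳ μ⊆) y>μ = ⊆-below-empty y≤w μ⊆ y>μ
⊆-below-empty (y≤z ∷ _) (refl ∷ _) (y>z ∷ _) = ⊥-elim (<⇒≱ y>z y≤z)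

decreasing-in-sorted : ∀ {r μ : List ℕ} → AllPairs _≤_ r → μ ⊆ r → Decreasing μ →
  μ ≡ [] ⊎ Σ ℕ λ z → μ ≡ [ z ] × z ∈ r
decreasing-in-sorted _ [] _ = inj₁ refl
decreasing-in-sorted (_ ∷ sorted) (_ ∷ʳ μ⊆) dec with decreasing-in-sorted sorted μ⊆ dec
... | inj₁ μ≡[] = inj₁ μ≡[]
... | inj₂ (z , μ≡[z] , z∈r) = inj₂ (z , μ≡[z] , there z∈r)
decreasing-in-sorted {z ∷ r} (z≤r ∷ _) (refl ∷ μ⊆) (z>μ ∷ _) with ⊆-below-empty z≤r μ⊆ z>μ
... | refl = inj₂ (z , refl , here refl)

rowInsert-append : ∀ x R {R′} → rowInsert x R ≡ (R′ , nothing) → R′ ≡ R ++ [ x ]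
rowInsert-append x [] refl = refl
rowInsert-append x (y ∷ ys) eq with x <? y
rowInsert-append x (y ∷ ys) () | yes _
... | no _ with rowInsert x ys in eq′
rowInsert-append x (y ∷ ys) refl | no _ | ys′ , nothing = cong (y ∷_) (rowInsert-append x ys eq′)

rowInsert-bump : ∀ x R {R′ b} → rowInsert x R ≡ (R′ , just b) → b ∈ R × x < b
rowInsert-bump x [] ()
rowInsert-bump x (y ∷ ys) eq with x <? y
rowInsert-bump x (y ∷ ys) refl | yes x<y = here refl , x<y
... | no _ with rowInsert x ys in eq′
rowInsert-bump x (y ∷ ys) refl | no _ | ys′ , just b with rowInsert-bump x ys eq′
... | b∈ys , x<b = there b∈ys , x<b

rowInsert-All : ∀ {P : ℕ → Set} x R {R′ mb} → All P R → P x → rowInsert x R ≡ (R′ , mb) → All P R′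
rowInsert-All x [] _ px refl = px ∷ []
rowInsert-All x (y ∷ ys) _ px eq with x <? y
rowInsert-All x (y ∷ ys) (_ ∷ pys) px refl | yes _ = px ∷ pys
... | no _ with rowInsert x ys in eq′
rowInsert-All x (y ∷ ys) (py ∷ pys) px refl | no _ | ys′ , mb = py ∷ rowInsert-All x ys pys px eq′

rowInsert-sorted : ∀ x R {R′ mb} → AllPairs _≤_ R → rowInsert x R ≡ (R′ , mb) → AllPairs _≤_ R′
rowInsert-sorted x [] _ refl = [] ∷ []
rowInsert-sorted x (y ∷ ys) _ eq with x <? y
rowInsert-sorted x (y ∷ ys) (y≤ys ∷ sorted) refl | yes x<y = All.map (≤-trans (<⇒≤ x<y)) y≤ys ∷ sorted
... | no x≮y with rowInsert x ys in eq′
rowInsert-sorted x (y ∷ ys) (y≤ys ∷ sorted) refl | no x≮y | ys′ , mb =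
  rowInsert-All {P = y ≤_} x ys y≤ys (≮⇒≥ x≮y) eq′ ∷ rowInsert-sorted x ys sorted eq′

rowInsert-⊴ : ∀ x R {R′ b} → AllPairs _≤_ R → rowInsert x R ≡ (R′ , just b) → R ++ [ x ] ⊴ b ∷ R′
rowInsert-⊴ x [] _ ()
rowInsert-⊴ x (y ∷ ys) _ eq with x <? y
rowInsert-⊴ x (y ∷ ys) sorted@(y≤ys ∷ _) refl | yes x<y = go
  where
  y≤ : ∀ {z} → z ∈ y ∷ ys → y ≤ z
  y≤ (here refl) = ≤-refl
  y≤ (there z∈ys) = All.lookup y≤ys z∈ys
  go : (y ∷ ys) ++ [ x ] ⊴ y ∷ x ∷ ys
  go μ μ⊆ dec with ⊆-++-split (y ∷ ys) μ⊆
  ... | μ₁ , μ₂ , refl , μ₁⊆ , μ₂⊆ with AllPairs-++⁻ μ₁ dec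
  ... | dec₁ , _ , _ with decreasing-in-sorted sorted μ₁⊆ dec₁ | μ₂⊆
  ... | inj₁ refl | _ ∷ʳ [] = [] , []⊆-universal _ , [] , z≤n , BoundedBy-refl
  ... | inj₁ refl | refl ∷ [] = [ x ] , y ∷ʳ (refl ∷ []⊆-universal ys) , [] ∷ [] , ≤-refl , BoundedBy-refl
  ... | inj₂ (z , refl , here refl) | _ ∷ʳ [] = [ y ] , refl ∷ []⊆-universal _ , [] ∷ [] , ≤-refl , BoundedBy-refl
  ... | inj₂ (z , refl , there z∈ys) | _ ∷ʳ [] = [ z ] , y ∷ʳ (x ∷ʳ from∈ z∈ys) , [] ∷ [] , ≤-refl , BoundedBy-refl
  ... | inj₂ (z , refl , z∈) | refl ∷ [] =
    y ∷ x ∷ [] , refl ∷ refl ∷ []⊆-universal ys , (x<y ∷ []) ∷ [] ∷ [] , ≤-refl ,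
    (λ { a (a>z ∷ a>x ∷ []) → ≤-<-trans (y≤ z∈) a>z ∷ a>x ∷ [] }) ,
    (λ { c (z>c ∷ x>c ∷ []) → <-trans x>c x<y ∷ x>c ∷ [] })
... | no x≮y with rowInsert x ys in eq′
rowInsert-⊴ x (y ∷ ys) (y≤ys ∷ sorted) refl | no x≮y | ys′ , just b = go
  where
  go : y ∷ (ys ++ [ x ]) ⊴ b ∷ y ∷ ys′
  go μ (_ ∷ʳ μ⊆) dec = ReplacementIn-⊆ (refl ∷ (y ∷ʳ ⊆-refl)) (rowInsert-⊴ x ys sorted eq′ μ μ⊆ dec)
  go (_ ∷ μ) (refl ∷ μ⊆) (y>μ ∷ _) with ⊆-below-empty (All.++⁺ y≤ys (≮⇒≥ x≮y ∷ [])) μ⊆ y>μ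
  ... | refl = [ y ] , b ∷ʳ (refl ∷ []⊆-universal ys′) , [] ∷ [] , ≤-refl , BoundedBy-refl

rowInsert-⊵ : ∀ x R {R′ b} → AllPairs _≤_ R → rowInsert x R ≡ (R′ , just b) → b ∷ R′ ⊴ R ++ [ x ]
rowInsert-⊵ x [] _ ()
rowInsert-⊵ x (y ∷ ys) _ eq with x <? y
rowInsert-⊵ x (y ∷ ys) (y≤ys ∷ _) refl | yes x<y = go
  where
  x≤ys : All (x ≤_) ys
  x≤ys = All.map (≤-trans (<⇒≤ x<y)) y≤ys
  go : y ∷ x ∷ ys ⊴ (y ∷ ys) ++ [ x ]
  go (_ ∷ _) (refl ∷ (refl ∷ μ⊆)) dec@((_ ∷ x>μ) ∷ _) with ⊆-below-empty y≤ys μ⊆ x>μ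
  ... | refl = _ , refl ∷ ++⁺ˡ ys (refl ∷ []) , dec , ≤-refl , BoundedBy-refl
  go (_ ∷ _) (refl ∷ (_ ∷ʳ μ⊆)) dec@(y>μ ∷ _) with ⊆-below-empty y≤ys μ⊆ y>μ
  ... | refl = _ , refl ∷ []⊆-universal _ , dec , ≤-refl , BoundedBy-refl
  go (_ ∷ _) (_ ∷ʳ (refl ∷ μ⊆)) dec@(x>μ ∷ _) with ⊆-below-empty x≤ys μ⊆ x>μ
  ... | refl = _ , y ∷ʳ ++⁺ˡ ys (refl ∷ []) , dec , ≤-refl , BoundedBy-refl
  go μ (_ ∷ʳ (_ ∷ʳ μ⊆)) dec = μ , y ∷ʳ ++⁺ʳ [ x ] μ⊆ , dec , ≤-refl , BoundedBy-refl
... | no x≮y with rowInsert x ys in eq′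
rowInsert-⊵ x (y ∷ ys) (y≤ys ∷ sorted) refl | no x≮y | ys′ , just b = go
  where
  y≤x = ≮⇒≥ x≮y
  y≤ys′ : All (y ≤_) ys′
  y≤ys′ = rowInsert-All {P = y ≤_} x ys y≤ys y≤x eq′
  b∈ys = proj₁ (rowInsert-bump x ys eq′)
  x<b = proj₂ (rowInsert-bump x ys eq′)
  go : b ∷ y ∷ ys′ ⊴ (y ∷ ys) ++ [ x ]
  go (_ ∷ _) (_ ∷ʳ (refl ∷ μ⊆)) dec@(y>μ ∷ _) with ⊆-below-empty y≤ys′ μ⊆ y>μ
  ... | refl = _ , refl ∷ []⊆-universal _ , dec , ≤-refl , BoundedBy-refl
  go μ (_ ∷ʳ (_ ∷ʳ μ⊆)) dec = ReplacementIn-⊆ (y ∷ʳ ⊆-refl) (rowInsert-⊵ x ys sorted eq′ μ (b ∷ʳ μ⊆) dec)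
  go (_ ∷ _ ∷ _) (refl ∷ (refl ∷ μ⊆)) (_ ∷ y>μ ∷ _) with ⊆-below-empty y≤ys′ μ⊆ y>μ
  ... | refl = b ∷ x ∷ [] , y ∷ʳ ⊆-++⁺ (from∈ b∈ys) (refl ∷ []) , (x<b ∷ []) ∷ [] ∷ [] , ≤-refl ,
    (λ { a (a>b ∷ _ ∷ []) → a>b ∷ <-trans x<b a>b ∷ [] }) ,
    (λ { c (b>c ∷ y>c ∷ []) → b>c ∷ <-≤-trans y>c y≤x ∷ [] })
  go (_ ∷ _) (refl ∷ (_ ∷ʳ μ⊆)) dec = ReplacementIn-⊆ (y ∷ʳ ⊆-refl) (rowInsert-⊵ x ys sorted eq′ _ (refl ∷ μ⊆) dec)

rowInsert-≍ : ∀ x R {R′ b} → AllPairs _≤_ R → rowInsert x R ≡ (R′ , just b) → R ++ [ x ] ≍ b ∷ R′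
rowInsert-≍ x R sorted eq = ⊴⇒≼ (rowInsert-⊴ x R sorted eq) , ⊴⇒≼ (rowInsert-⊵ x R sorted eq)

reading : Tableau → List ℕ
reading [] = []
reading (row ∷ rows) = reading rows ++ row

-- Weaker than semistandard: besides sorted rows only the first column is required to increase strictly.
WellFormed : Tableau → Set
WellFormed [] = ⊤
WellFormed (row ∷ rows) =
  1 ≤ length row × AllPairs _≤_ row × All (λ row′ → headOr0 row < headOr0 row′) rows × WellFormed rows

insertT-≍ : ∀ x T → WellFormed T → reading T ++ [ x ] ≍ reading (insertT x T)
insertT-≍ x [] _ = ≍-reflexive refl
insertT-≍ x (row ∷ rows) (_ , sorted , _ , wf) with rowInsert x row in eq
... | row′ , nothing =
  ≍-reflexive (trans (++-assoc (reading rows) row [ x ])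
                     (cong (reading rows ++_) (sym (rowInsert-append x row eq))))
... | row′ , just b =
  ≍-trans (≍-reflexive (++-assoc (reading rows) row [ x ]))
  (≍-trans (≍-prefix (reading rows) (rowInsert-≍ x row sorted eq))
  (≍-trans (≍-reflexive (sym (++-assoc (reading rows) [ b ] row′)))
           (≍-suffix row′ (insertT-≍ b rows wf))))

rowInsert-head : ∀ {Q : ℕ → Set} y R {R′ mb} → rowInsert y R ≡ (R′ , mb) → Q (headOr0 R) → Q y → Q (headOr0 R′)
rowInsert-head y [] refl _ qy = qy
rowInsert-head y (z ∷ zs) eq qz qy with y <? z
rowInsert-head y (z ∷ zs) refl qz qy | yes _ = qy
... | no _ with rowInsert y zs in eq′
rowInsert-head y (z ∷ zs) refl qz qy | no _ | zs′ , mb = qz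

insertT-heads : ∀ {Q : ℕ → Set} y T → All (λ row → Q (headOr0 row)) T → (∀ {z} → y ≤ z → Q z) →
  All (λ row → Q (headOr0 row)) (insertT y T)
insertT-heads y [] _ Q≥y = Q≥y ≤-refl ∷ []
insertT-heads {Q} y (row ∷ rows) (q ∷ qs) Q≥y with rowInsert y row in eq
... | row′ , nothing = rowInsert-head y row eq q (Q≥y ≤-refl) ∷ qs
... | row′ , just b =
  rowInsert-head y row eq q (Q≥y ≤-refl) ∷
  insertT-heads b rows qs (λ b≤z → Q≥y (≤-trans (<⇒≤ (proj₂ (rowInsert-bump y row eq))) b≤z))

insertT-wellFormed : ∀ x T → WellFormed T → WellFormed (insertT x T)
insertT-wellFormed x [] tt = s≤s z≤n , [] ∷ [] , [] , tt
insertT-wellFormed x ((h ∷ t) ∷ rows) (_ , (h≤t ∷ sorted) , h<heads , wf) with x <? h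
... | yes x<h =
  s≤s z≤n , All.map (≤-trans (<⇒≤ x<h)) h≤t ∷ sorted ,
  insertT-heads {Q = x <_} h rows (All.map (<-trans x<h) h<heads) (<-≤-trans x<h) ,
  insertT-wellFormed h rows wf
... | no x≮h with rowInsert x t in eq
... | t′ , nothing =
  s≤s z≤n , rowInsert-All {P = h ≤_} x t h≤t (≮⇒≥ x≮h) eq ∷ rowInsert-sorted x t sorted eq , h<heads , wf
... | t′ , just b =
  s≤s z≤n , rowInsert-All {P = h ≤_} x t h≤t (≮⇒≥ x≮h) eq ∷ rowInsert-sorted x t sorted eq ,
  insertT-heads {Q = h <_} b rows h<heads
    (λ b≤z → ≤-<-trans (≮⇒≥ x≮h) (<-≤-trans (proj₂ (rowInsert-bump x t eq)) b≤z)) ,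
  insertT-wellFormed b rows wf

insertAll : Tableau → List ℕ → Tableau
insertAll = foldl (λ T x → insertT x T)

insertAll-wellFormed : ∀ T w → WellFormed T → WellFormed (insertAll T w)
insertAll-wellFormed T [] wf = wf
insertAll-wellFormed T (x ∷ w) wf = insertAll-wellFormed (insertT x T) w (insertT-wellFormed x T wf)

insertAll-≍ : ∀ T w → WellFormed T → reading T ++ w ≍ reading (insertAll T w)
insertAll-≍ T [] wf = ≍-reflexive (++-identityʳ (reading T))
insertAll-≍ T (x ∷ w) wf =
  ≍-trans (≍-reflexive (sym (++-assoc (reading T) [ x ] w)))
  (≍-trans (≍-suffix w (insertT-≍ x T wf))
           (insertAll-≍ (insertT x T) w (insertT-wellFormed x T wf)))

reading-decreasing-≤ : ∀ T → WellFormed T → ∀ {σ} → σ ⊆ reading T → Decreasing σ → length σ ≤ length T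
reading-decreasing-≤ [] _ [] _ = z≤n
reading-decreasing-≤ (row ∷ rows) (_ , sorted , _ , wf) σ⊆ dec with ⊆-++-split (reading rows) σ⊆
... | σ₁ , σ₂ , refl , σ₁⊆ , σ₂⊆ with AllPairs-++⁻ σ₁ dec
... | dec₁ , dec₂ , _ rewrite length-++ σ₁ {σ₂} | +-comm (length σ₁) (length σ₂)
  with decreasing-in-sorted sorted σ₂⊆ dec₂
... | inj₁ refl = m≤n⇒m≤1+n (reading-decreasing-≤ rows wf σ₁⊆ dec₁)
... | inj₂ (_ , refl , _) = s≤s (reading-decreasing-≤ rows wf σ₁⊆ dec₁)

firstColumn : Tableau → List ℕ
firstColumn [] = []
firstColumn (row ∷ rows) = firstColumn rows ++ [ headOr0 row ]

firstColumn-⊆ : ∀ T → WellFormed T → firstColumn T ⊆ reading T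
firstColumn-⊆ [] _ = []
firstColumn-⊆ ((h ∷ t) ∷ rows) (_ , _ , _ , wf) = ⊆-++⁺ (firstColumn-⊆ rows wf) (refl ∷ []⊆-universal t)

firstColumn-decreasing : ∀ T → WellFormed T → Decreasing (firstColumn T)
firstColumn-decreasing [] _ = []
firstColumn-decreasing (row ∷ rows) (_ , _ , h<heads , wf) =
  AllPairs.++⁺ (firstColumn-decreasing rows wf) ([] ∷ []) (column>h rows h<heads)
  where
  column>h : ∀ rows → All (λ row′ → headOr0 row < headOr0 row′) rows →
    All (λ z → All (z >_) [ headOr0 row ]) (firstColumn rows)
  column>h [] [] = []
  column>h (_ ∷ rows) (h<h′ ∷ h<heads) = All.++⁺ (column>h rows h<heads) ((h<h′ ∷ []) ∷ [])

length-firstColumn : ∀ T → length (firstColumn T) ≡ length T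
length-firstColumn [] = refl
length-firstColumn (row ∷ rows) rewrite length-++ (firstColumn rows) {[ headOr0 row ]} | length-firstColumn rows =
  +-comm (length rows) 1

≼-whole : ∀ {w₁ w₂ σ} → w₁ ≼ w₂ → σ ⊆ w₁ → Decreasing σ → HasDecSubseq≥ w₂ (length σ)
≼-whole {w₁} {w₂} {σ} w₁≼w₂ σ⊆ dec with w₁≼w₂ [] [] σ (subst (σ ⊆_) (sym (++-identityʳ w₁)) σ⊆) dec
... | τ , τ⊆ , dec′ , σ≤τ = τ , subst (τ ⊆_) (++-identityʳ w₂) τ⊆ , dec′ , σ≤τ

RSP-wellFormed : ∀ π → WellFormed (RSP π)
RSP-wellFormed π = insertAll-wellFormed [] π tt

schensted-≤ : ∀ π {σ} → σ ⊆ π → Decreasing σ → length σ ≤ length (RSP π)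
schensted-≤ π σ⊆ dec with ≼-whole (proj₁ (insertAll-≍ [] π tt)) σ⊆ dec
... | τ , τ⊆ , dec′ , σ≤τ = ≤-trans σ≤τ (reading-decreasing-≤ (RSP π) (RSP-wellFormed π) τ⊆ dec′)

schensted-≥ : ∀ π → HasDecSubseq≥ π (length (RSP π))
schensted-≥ π
  with ≼-whole (proj₂ (insertAll-≍ [] π tt)) (firstColumn-⊆ (RSP π) (RSP-wellFormed π))
               (firstColumn-decreasing (RSP π) (RSP-wellFormed π))
... | τ , τ⊆ , dec , column≤τ = τ , τ⊆ , dec , subst (_≤ length τ) (length-firstColumn (RSP π)) column≤τ

conjugate-head : ∀ {λ₀ m ms} → All (1 ≤_) λ₀ → conjugate λ₀ ≡ m ∷ ms → length λ₀ ≡ m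
conjugate-head {suc l ∷ ls} positive eq =
  trans (sym (cong length (filter-all (1 ≤?_) positive))) (∷-injectiveˡ eq)

twoParts-head : ∀ s r → Σ (List ℕ) λ ms → twoParts s r ≡ s ∷ ms
twoParts-head s zero = _ , refl
twoParts-head s (suc r) = _ , refl

wellFormed-rows-nonempty : ∀ T → WellFormed T → All (1 ≤_) (map length T)
wellFormed-rows-nonempty [] _ = []
wellFormed-rows-nonempty (row ∷ rows) (nonempty , _ , _ , wf) = nonempty ∷ wellFormed-rows-nonempty rows wf

length-RSP : ∀ π {s r} → conjugate (shape π) ≡ twoParts s r → length (RSP π) ≡ s
length-RSP π {s} {r} conj =
  trans (sym (length-map length (RSP π)))
        (conjugate-head (wellFormed-rows-nonempty (RSP π) (RSP-wellFormed π))
                        (trans conj (proj₂ (twoParts-head s r))))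

IsPerm-length : ∀ {n π} → IsPerm n π → length π ≡ n
IsPerm-length {n} perm = trans (↭-length perm) (trans (length-map suc (upTo n)) (length-applyUpTo (λ i → i) n))

IsPerm-unique : ∀ {n π} → IsPerm n π → Unique π
IsPerm-unique {n} perm =
  ↭ₛ.Unique-resp-↭ (setoid ℕ) (↭⇒↭ₛ′ isEquivalence (↭-sym perm)) (Unique.map⁺ suc-injective (Unique.upTo⁺ n))

IsPerm-range : ∀ {n π p} → IsPerm n π → p ∈ π → 1 ≤ p × p ≤ n
IsPerm-range perm p∈π with ∈-map⁻ suc (∈-resp-↭ perm p∈π)
... | i , i∈ , refl = s≤s z≤n , ∈-upTo⁻ i∈

-- Heights

climb : (ℕ → ℕ) → ℕ → List ℕ → ℕ
climb f x [] = 0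
climb f x (y ∷ w) with y <? x
... | yes _ = suc (f y) ⊔ climb f x w
... | no _ = climb f x w

climb-> : ∀ f x w {b} → b ∈ w → b < x → f b < climb f x w
climb-> f x (y ∷ w) b∈ b<x with y <? x
climb-> f x (y ∷ w) (here refl) b<x | yes _ = m≤m⊔n _ (climb f x w)
climb-> f x (y ∷ w) (there b∈w) b<x | yes _ = <-≤-trans (climb-> f x w b∈w b<x) (m≤n⊔m (suc (f y)) _)
climb-> f x (y ∷ w) (here refl) b<x | no b≮x = ⊥-elim (b≮x b<x)
climb-> f x (y ∷ w) (there b∈w) b<x | no _ = climb-> f x w b∈w b<x

climb-attained : ∀ f x w → climb f x w ≡ 0 ⊎ Σ ℕ λ y → y ∈ w × y < x × climb f x w ≡ suc (f y)
climb-attained f x [] = inj₁ refl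
climb-attained f x (y ∷ w) with y <? x | ⊔-sel (suc (f y)) (climb f x w) | climb-attained f x w
... | yes y<x | inj₁ c≡ | _ = inj₂ (y , here refl , y<x , c≡)
... | yes _ | inj₂ c≡ | inj₁ c′≡0 = inj₁ (trans c≡ c′≡0)
... | yes _ | inj₂ c≡ | inj₂ (z , z∈w , z<x , c′≡) = inj₂ (z , there z∈w , z<x , trans c≡ c′≡)
... | no _ | _ | inj₁ c≡0 = inj₁ c≡0
... | no _ | _ | inj₂ (z , z∈w , z<x , c≡) = inj₂ (z , there z∈w , z<x , c≡)

-- For w without repetitions, height w y + 1 is the length of the longest decreasing subsequence of w
-- starting at y.
height : List ℕ → ℕ → ℕ
height [] y = 0
height (x ∷ w) y with y ≟ x
... | yes _ = climb (height w) x w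
... | no _ = height w y

height-here : ∀ x w → height (x ∷ w) x ≡ climb (height w) x w
height-here x w with x ≟ x
... | yes _ = refl
... | no x≢x = ⊥-elim (x≢x refl)

height-there : ∀ {x y} w → y ≢ x → height (x ∷ w) y ≡ height w y
height-there {x} {y} w y≢x with y ≟ x
... | yes y≡x = ⊥-elim (y≢x y≡x)
... | no _ = refl

∈-∉-≢ : ∀ {x y : A} {w} → All (x ≢_) w → y ∈ w → y ≢ x
∈-∉-≢ x∉w y∈w y≡x = All.lookup x∉w y∈w (sym y≡x)

height-chain : ∀ {w y} → Unique w → y ∈ w →
  Σ (List ℕ) λ σ → y ∷ σ ⊆ w × Decreasing (y ∷ σ) × length σ ≡ height w y
height-chain {x ∷ w} (_ ∷ u) (here refl) rewrite height-here x w with climb-attained (height w) x w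
... | inj₁ c≡0 = [] , refl ∷ []⊆-universal w , [] ∷ [] , sym c≡0
... | inj₂ (z , z∈w , z<x , c≡) with height-chain u z∈w
...   | σ , z∷σ⊆ , dec@(z>σ ∷ _) , |σ| =
  z ∷ σ , refl ∷ z∷σ⊆ , (z<x ∷ All.map (λ z>v → <-trans z>v z<x) z>σ) ∷ dec , trans (cong suc |σ|) (sym c≡)
height-chain {x ∷ w} (x∉w ∷ u) (there y∈w) rewrite height-there w (∈-∉-≢ x∉w y∈w) with height-chain u y∈w
... | σ , y∷σ⊆ , dec , |σ| = σ , x ∷ʳ y∷σ⊆ , dec , |σ|

height-descent : ∀ {w a b} → Unique w → a ∷ b ∷ [] ⊆ w → b < a → height w b < height w a
height-descent {x ∷ w} (x∉w ∷ u) (_ ∷ʳ ab⊆) b<a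
  rewrite height-there w (∈-∉-≢ x∉w (lookup ab⊆ (here refl)))
        | height-there w (∈-∉-≢ x∉w (lookup ab⊆ (there (here refl)))) = height-descent u ab⊆ b<a
height-descent {x ∷ w} (x∉w ∷ _) (refl ∷ b⊆) b<x
  rewrite height-here x w | height-there w (∈-∉-≢ x∉w (lookup b⊆ (here refl))) =
  climb-> (height w) x w (lookup b⊆ (here refl)) b<x

heights-descend : ∀ {w σ} → Unique w → σ ⊆ w → Decreasing σ → AllPairs (λ a b → height w b < height w a) σ
heights-descend w-unique σ⊆ dec =
  AllPairs.zipWith (λ (b<a , ab⊆) → height-descent w-unique ab⊆ b<a) (dec , ⊆-pairs σ⊆)

height-injective : ∀ {w σ a b} → Unique w → σ ⊆ w → Decreasing σ →
  a ∈ σ → b ∈ σ → height w a ≡ height w b → a ≡ b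
height-injective {w} w-unique σ⊆ dec =
  AllPairs-injective (height w)
    (AllPairs.map (λ hb<ha ha≡hb → <-irrefl (sym ha≡hb) hb<ha) (heights-descend w-unique σ⊆ dec))

-- Entries lying on every longest decreasing subsequence

module _ {π : List ℕ} {k : ℕ} (lds-≤ : ∀ {σ} → σ ⊆ π → Decreasing σ → length σ ≤ k) where

  IsLDS⇒OfLength : ∀ {σ₀ σ} → DecSubseqOfLength π k σ₀ → IsLDS σ π → DecSubseqOfLength π k σ
  IsLDS⇒OfLength (σ₀⊆ , dec₀ , |σ₀|) ((σ⊆ , linked) , longest) =
    σ⊆ , dec , ≤-antisym (lds-≤ σ⊆ dec) (subst (_≤ _) |σ₀| (longest _ (σ₀⊆ , AllPairs⇒Linked dec₀)))
    where dec = Linked⇒AllPairs >-trans linked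

  deleteEntry-lds : ∀ {p σ₀} → DecSubseqOfLength π k σ₀ → p ∈ σ₀ →
    (∀ {σ} → DecSubseqOfLength π k σ → p ∈ σ) → HasLDSLength (deleteEntry p π) (k ∸ 1)
  deleteEntry-lds {p} {σ₀} (σ₀⊆ , dec₀ , |σ₀|) p∈σ₀ in-every =
    deleteEntry p σ₀ , ((σ₀∖p⊆ , AllPairs⇒Linked (AllPairs.filter⁺ keep? dec₀)) , shorter) , |σ₀∖p|
    where
    keep? = λ y → ¬? (y ≟ p)
    σ₀∖p⊆ : deleteEntry p σ₀ ⊆ deleteEntry p π
    σ₀∖p⊆ = ⊆-filter⁺ keep? keep? (λ { refl q → q }) σ₀⊆
    |σ₀∖p| : length (deleteEntry p σ₀) ≡ k ∸ 1
    |σ₀∖p| = cong (_∸ 1) (trans (length-deleteEntry (AllPairs.map >⇒≢ dec₀) p∈σ₀) |σ₀|)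
    p∉π∖p : p ∉ deleteEntry p π
    p∉π∖p p∈ = proj₂ (∈-filter⁻ keep? {xs = π} p∈) refl
    shorter : ∀ τ → IsDecSubseq τ (deleteEntry p π) → length τ ≤ length (deleteEntry p σ₀)
    shorter τ (τ⊆ , linked) = subst (length τ ≤_) (sym |σ₀∖p|) (∸-monoˡ-≤ 1 (≤∧≢⇒< (lds-≤ τ⊆π dec) |τ|≢k))
      where
      τ⊆π = ⊆-trans τ⊆ (filter-⊆ keep? π)
      dec = Linked⇒AllPairs >-trans linked
      |τ|≢k : length τ ≢ k
      |τ|≢k |τ|≡k = p∉π∖p (lookup τ⊆ (in-every (τ⊆π , dec , |τ|≡k)))

  module _ (π-unique : Unique π) where

    height-< : ∀ {y} → y ∈ π → height π y < k
    height-< y∈π with height-chain π-unique y∈π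
    ... | σ , y∷σ⊆ , dec , |σ| = subst (λ h → suc h ≤ k) |σ| (lds-≤ y∷σ⊆ dec)

    longest-covers-heights : ∀ {σ i} → DecSubseqOfLength π k σ → i < k → Σ ℕ λ a → a ∈ σ × height π a ≡ i
    longest-covers-heights {σ} (σ⊆ , dec , |σ|) i<k
      with ∈-map⁻ (height π) (decreasing-covers heights-decreasing heights<k i<|hs|)
      where
      hs = map (height π) σ
      |hs| : length hs ≡ k
      |hs| = trans (length-map (height π) σ) |σ|
      heights-decreasing : Decreasing hs
      heights-decreasing = AllPairs.map⁺ (heights-descend π-unique σ⊆ dec)
      heights<k : All (_< length hs) hs
      heights<k =
        All.map⁺ (All.tabulate (λ a∈σ → subst (height π _ <_) (sym |hs|) (height-< (lookup σ⊆ a∈σ))))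
      i<|hs| = subst (_ <_) (sym |hs|) i<k
    ... | a , a∈σ , i≡ = a , a∈σ , sym i≡

    lds-pivot : ∀ {r σ₀} → length π ≡ k + r → r < k → DecSubseqOfLength π k σ₀ →
      Σ ℕ λ p → p ∈ σ₀ × (∀ {σ} → DecSubseqOfLength π k σ → p ∈ σ)
    lds-pivot {r} {σ₀} |π| r<k σ₀-ok@(σ₀⊆ , dec₀ , |σ₀|)
      with ∃-∉-below k (map (height π) rest) |heights-rest|<k
      where
      rest = filter (λ y → ¬? (y ∈? σ₀)) π
      σ₀⊆kept : σ₀ ⊆ filter (_∈? σ₀) π
      σ₀⊆kept = subst (_⊆ filter (_∈? σ₀) π) (filter-all (_∈? σ₀) (All.tabulate (λ m → m)))
                      (⊆-filter⁺ (_∈? σ₀) (_∈? σ₀) (λ { refl m → m }) σ₀⊆)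
      |rest|≤r : length rest ≤ r
      |rest|≤r = +-cancelˡ-≤ k (length rest) r (begin
        k + length rest                          ≡⟨ cong (_+ length rest) (sym |σ₀|) ⟩
        length σ₀ + length rest                  ≤⟨ +-monoˡ-≤ (length rest) (length-mono-≤ σ₀⊆kept) ⟩
        length (filter (_∈? σ₀) π) + length rest ≡⟨ length-filter-∁ (_∈? σ₀) π ⟩
        length π                                 ≡⟨ |π| ⟩
        k + r                                    ∎)
        where open ≤-Reasoning
      |heights-rest|<k : length (map (height π) rest) < k
      |heights-rest|<k = subst (_< k) (sym (length-map (height π) rest)) (≤-<-trans |rest|≤r r<k)
    ... | i , i<k , i∉ with longest-covers-heights σ₀-ok i<k
    ... | p , p∈σ₀ , hp≡i = p , p∈σ₀ , in-every
      where
      in-every : ∀ {σ} → DecSubseqOfLength π k σ → p ∈ σ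
      in-every {σ} σ-ok@(σ⊆ , _ , _) with q , q∈σ , hq≡i ← longest-covers-heights σ-ok i<k | q ∈? σ₀
      ... | yes q∈σ₀ =
        subst (_∈ σ) (height-injective π-unique σ₀⊆ dec₀ q∈σ₀ p∈σ₀ (trans hq≡i (sym hp≡i))) q∈σ
      ... | no q∉σ₀ = ⊥-elim (i∉ (subst (_∈ _) hq≡i (∈-map⁺ (height π) q∈rest)))
        where q∈rest = ∈-filter⁺ (λ y → ¬? (y ∈? σ₀)) (lookup σ⊆ q∈σ) q∉σ₀

    ∃-essential-entry : ∀ {r} → length π ≡ k + r → r < k → HasDecSubseq≥ π k →
      Σ ℕ λ p → p ∈ π × HasLDSLength (deleteEntry p π) (k ∸ 1) × ((σ : List ℕ) → IsLDS σ π → p ∈ σ)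
    ∃-essential-entry |π| r<k (σ₀ , σ₀⊆ , dec₀ , k≤|σ₀|)
      with |σ₀| ← ≤-antisym (lds-≤ σ₀⊆ dec₀) k≤|σ₀|
      with p , p∈σ₀ , in-every ← lds-pivot |π| r<k (σ₀⊆ , dec₀ , |σ₀|) =
      p , lookup σ₀⊆ p∈σ₀ , deleteEntry-lds (σ₀⊆ , dec₀ , |σ₀|) p∈σ₀ in-every ,
      λ σ σ-lds → in-every (IsLDS⇒OfLength (σ₀⊆ , dec₀ , |σ₀|) σ-lds)

corollary24 : (s r : ℕ) → r < s → (π : List ℕ) → IsPerm (s + r) π →
    conjugate (shape π) ≡ twoParts s r →
    Σ ℕ (λ p → (1 ≤ p × p ≤ s + r)
    × HasLDSLength (deleteEntry p π) (s ∸ 1)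
    × ((σ : List ℕ) → IsLDS σ π → p ∈ σ))
corollary24 s r r<s π perm conj =
  let p , p∈π , deletion , essential =
        ∃-essential-entry lds-≤ (IsPerm-unique perm) (IsPerm-length perm) r<s lds-≥
  in p , IsPerm-range perm p∈π , deletion , essential
  where
  rows≡s : length (RSP π) ≡ s
  rows≡s = length-RSP π conj
  lds-≤ : ∀ {σ} → σ ⊆ π → Decreasing σ → length σ ≤ s
  lds-≤ σ⊆ dec = subst (_ ≤_) rows≡s (schensted-≤ π σ⊆ dec)
  lds-≥ : HasDecSubseq≥ π s
  lds-≥ = subst (HasDecSubseq≥ π) rows≡s (schensted-≥ π)
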